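{- Let $q$ be a power of an odd prime, let $\alpha,\beta$ be generators of $\mathbb{F}_q^*$, and let $C$ be the Golomb-Costas array of order $q-2$ defined by $\alpha,\beta$. Then the number of even/even dots in $C$ equals the number of elements $z\in\mathbb{F}_q^*$ with $z\ne 1$ such that both $z$ and $1-z$ are squares in $\mathbb{F}_q$.
   Context: $\mathbb{F}_q$ is the finite field with $q$ elements and $\mathbb{F}_q^*$ its cyclic multiplicative group. Given generators $\alpha,\beta$ of $\mathbb{F}_q^*$ (possibly $\alpha=\beta$), the Golomb-Costas array of order $q-2$ is the $(q-2)\times(q-2)$ array with a dot in position $(i,j)$ (row $i$, column $j$, $1\le i,j\le q-2$) exactly when $\alpha^i+\beta^j=1$. A dot in row $i$, column $j$ is even/even if $i$ and $j$ are both even. -}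

module Defs where

open import Level using (0ℓ)
open import Algebra.Bundles using (CommutativeRing)
open import Data.Nat using (ℕ; zero; suc; _∸_)
open import Data.Nat.Divisibility using (_∣_; _∣?_)
open import Data.Fin using (Fin)
open import Data.Fin.Properties using (any?)
open import Data.List using (List; length; filter; map; upTo; cartesianProduct; allFin)
open import Data.Product using (Σ; ∃; _×_; _,_; proj₁; proj₂)
open import Relation.Nullary using (¬_; Dec; yes; no)
open import Relation.Nullary.Decidable using (_×-dec_; ¬?)
open import Relation.Binary.PropositionalEquality using (_≡_)
open import Relation.Binary using (Decidable)

record FiniteField (q : ℕ) : Set₁ where
  field
    commRing : CommutativeRing 0ℓ 0ℓ
  open CommutativeRing commRing public
  field
    1≉0       : ¬ (1# ≈ 0#)
    inverse   : ∀ x → ¬ (x ≈ 0#) → ∃ λ y → x * y ≈ 1#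
    _≟_       : Decidable _≈_
    enum      : Fin q → Carrier
    enum-inj  : ∀ i j → enum i ≈ enum j → i ≡ j
    enum-surj : ∀ x → ∃ λ i → enum i ≈ x

module _ {q : ℕ} (F : FiniteField q) where
  open FiniteField F

  pow : Carrier → ℕ → Carrier
  pow x zero    = 1#
  pow x (suc n) = x * pow x n

  IsGenerator : Carrier → Set
  IsGenerator α = ¬ (α ≈ 0#) × (∀ x → ¬ (x ≈ 0#) → ∃ λ k → pow α k ≈ x)

  IsSquare : Carrier → Set
  IsSquare x = ∃ λ y → y * y ≈ x

  isSquare? : ∀ x → Dec (IsSquare x)
  isSquare? x with any? (λ i → (enum i * enum i) ≟ x)
  ... | yes (i , e) = yes (enum i , e)
  ... | no n = no λ { (y , e) → n (proj₁ (enum-surj y) ,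
                 trans (*-cong (proj₂ (enum-surj y)) (proj₂ (enum-surj y))) e) }

  indices : List ℕ
  indices = map suc (upTo (q ∸ 2))

  EvenEvenDot : Carrier → Carrier → ℕ × ℕ → Set
  EvenEvenDot α β (i , j) = (2 ∣ i) × (2 ∣ j) × ((pow α i + pow β j) ≈ 1#)

  evenEvenDot? : ∀ α β p → Dec (EvenEvenDot α β p)
  evenEvenDot? α β (i , j) = (2 ∣? i) ×-dec ((2 ∣? j) ×-dec ((pow α i + pow β j) ≟ 1#))

  evenEvenDotCount : Carrier → Carrier → ℕ
  evenEvenDotCount α β =
    length (filter (evenEvenDot? α β) (cartesianProduct indices indices))

  GoodElem : Carrier → Set
  GoodElem z = ¬ (z ≈ 0#) × ¬ (z ≈ 1#) × IsSquare z × IsSquare (1# - z)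

  goodElem? : ∀ z → Dec (GoodElem z)
  goodElem? z = ¬? (z ≟ 0#) ×-dec (¬? (z ≟ 1#) ×-dec (isSquare? z ×-dec isSquare? (1# - z)))

  goodElemCount : ℕ
  goodElemCount = length (filter (λ i → goodElem? (enum i)) (allFin q))

-- The even/even dots (i , j), 0 < i, j < n, α^i + β^j = 1,
-- i, j even, are in bijection with the elements z ∉ {0, 1} such that z and 1 - z
-- are squares: send a dot to z = α^i (then 1 - z = β^j), and send z to the pair
-- of discrete logarithms (log_α z , log_β (1 - z)).  The two counts are the
-- lengths of two duplicate-free lists, so it suffices to exhibit injections in
-- both directions.
module Submission where

open import Defs
open import Data.Nat using (ℕ; zero; suc; z≤n; s≤s; NonZero)
  renaming (_+_ to _+ℕ_; _*_ to _*ℕ_; _∸_ to _∸ℕ_; _≤_ to _≤ℕ_; _<_ to _<ℕ_)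
open import Data.Nat.DivMod using (_%_; _/_; m≡m%n+[m/n]*n; m%n<n)
open import Data.Nat.Divisibility using (_∣_; divides; ∣m+n∣m⇒∣n; ∣-trans; n∣m*n)
import Data.Nat.Properties as ℕ
open import Data.Fin using (Fin; toℕ; fromℕ<; punchIn; punchOut) renaming (zero to fzero)
import Data.Fin.Properties as Fin
open import Data.List using (List; []; _∷_; length; filter; cartesianProduct; allFin; _++_)
open import Data.List.Properties using (length-++)
open import Data.List.Membership.Propositional using (_∈_)
open import Data.List.Membership.Propositional.Properties
  using (∈-∃++; ∈-++⁻; ∈-++⁺ˡ; ∈-++⁺ʳ; ∈-map⁻; ∈-map⁺; ∈-upTo⁻; ∈-upTo⁺; ∈-filter⁻; ∈-filter⁺;
         ∈-cartesianProduct⁻; ∈-cartesianProduct⁺; ∈-allFin)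
open import Data.List.Relation.Unary.Any using (here; there)
import Data.List.Relation.Unary.All as All
open import Data.List.Relation.Unary.AllPairs using (_∷_)
open import Data.List.Relation.Unary.Unique.Propositional using (Unique)
import Data.List.Relation.Unary.Unique.Propositional.Properties as Unique
open import Data.Product using (∃; _×_; _,_; proj₁; proj₂)
open import Data.Sum using (inj₁; inj₂)
open import Data.Empty using (⊥; ⊥-elim)
open import Relation.Nullary using (¬_; yes; no)
open import Relation.Binary.PropositionalEquality as ≡ using (_≡_; _≢_)
open import Relation.Binary.Definitions using (tri<; tri≈; tri>)

length-≤-by-injection : {A B : Set} (f : A → B) {xs : List A} {ys : List B} → Unique xs →
  (∀ {a} → a ∈ xs → f a ∈ ys) →
  (∀ {a b} → a ∈ xs → b ∈ xs → f a ≡ f b → a ≡ b) →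
  length xs ≤ℕ length ys
length-≤-by-injection f {[]} unique into inj = z≤n
length-≤-by-injection f {a ∷ xs} (a∉xs ∷ unique) into inj
  with ys₁ , ys₂ , ≡.refl ← ∈-∃++ (into (here ≡.refl)) =
  ≡.subst (suc (length xs) ≤ℕ_) (≡.sym length-split)
    (s≤s (length-≤-by-injection f unique into′ (λ p p′ → inj (there p) (there p′))))
  where
  length-split : length (ys₁ ++ f a ∷ ys₂) ≡ suc (length (ys₁ ++ ys₂))
  length-split = ≡.trans (length-++ ys₁) (≡.trans (ℕ.+-suc (length ys₁) (length ys₂))
                   (≡.cong suc (≡.sym (length-++ ys₁))))
  into′ : ∀ {b} → b ∈ xs → f b ∈ ys₁ ++ ys₂
  into′ {b} p with ∈-++⁻ ys₁ (into (there p))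
  ... | inj₁ r         = ∈-++⁺ˡ r
  ... | inj₂ (here e)  = ⊥-elim (All.lookup a∉xs p (inj (here ≡.refl) (there p) (≡.sym e)))
  ... | inj₂ (there r) = ∈-++⁺ʳ ys₁ r

module FieldArithmetic {q : ℕ} (F : FiniteField q) where
  open FiniteField F
  open import Algebra.Properties.Group +-group using (∙-cancelʳ; x≈z//y; //-rightDividesˡ)
  open import Relation.Binary.Reasoning.Setoid setoid

  _^_ : Carrier → ℕ → Carrier
  _^_ = pow F

  ^-+ : ∀ x a b → x ^ (a +ℕ b) ≈ x ^ a * x ^ b
  ^-+ x zero    b = sym (*-identityˡ _)
  ^-+ x (suc a) b = trans (*-congˡ (^-+ x a b)) (sym (*-assoc _ _ _))

  ^-periodic : ∀ {x d} → x ^ d ≈ 1# → ∀ r t → x ^ (r +ℕ t *ℕ d) ≈ x ^ r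
  ^-periodic {x} {d} xᵈ≈1 r zero    = reflexive (≡.cong (x ^_) (ℕ.+-identityʳ r))
  ^-periodic {x} {d} xᵈ≈1 r (suc t) = begin
    x ^ (r +ℕ (d +ℕ t *ℕ d))  ≡⟨ ≡.cong (x ^_) (ℕ.+-comm r (d +ℕ t *ℕ d)) ⟩
    x ^ ((d +ℕ t *ℕ d) +ℕ r)  ≡⟨ ≡.cong (x ^_) (ℕ.+-assoc d (t *ℕ d) r) ⟩
    x ^ (d +ℕ (t *ℕ d +ℕ r))  ≈⟨ ^-+ x d _ ⟩
    x ^ d * x ^ (t *ℕ d +ℕ r) ≈⟨ *-cong xᵈ≈1 (reflexive (≡.cong (x ^_) (ℕ.+-comm (t *ℕ d) r))) ⟩
    1# * x ^ (r +ℕ t *ℕ d)    ≈⟨ *-identityˡ _ ⟩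
    x ^ (r +ℕ t *ℕ d)         ≈⟨ ^-periodic xᵈ≈1 r t ⟩
    x ^ r                     ∎

  ^-mod : ∀ {x} d .{{_ : NonZero d}} → x ^ d ≈ 1# → ∀ k → x ^ k ≈ x ^ (k % d)
  ^-mod {x} d xᵈ≈1 k = begin
    x ^ k                       ≡⟨ ≡.cong (x ^_) (m≡m%n+[m/n]*n k d) ⟩
    x ^ (k % d +ℕ (k / d) *ℕ d) ≈⟨ ^-periodic xᵈ≈1 (k % d) (k / d) ⟩
    x ^ (k % d)                 ∎

  *-cancelˡ-nonzero : ∀ {x a b} → ¬ (x ≈ 0#) → x * a ≈ x * b → a ≈ b
  *-cancelˡ-nonzero {x} {a} {b} x≉0 xa≈xb with y , xy≈1 ← inverse x x≉0 = begin
    a             ≈⟨ sym (*-identityˡ a) ⟩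
    1# * a        ≈⟨ *-congʳ (trans (sym xy≈1) (*-comm x y)) ⟩
    (y * x) * a   ≈⟨ *-assoc y x a ⟩
    y * (x * a)   ≈⟨ *-congˡ xa≈xb ⟩
    y * (x * b)   ≈⟨ sym (*-assoc y x b) ⟩
    (y * x) * b   ≈⟨ *-congʳ (trans (*-comm y x) xy≈1) ⟩
    1# * b        ≈⟨ *-identityˡ b ⟩
    b             ∎

  *-nonzero : ∀ {x y} → ¬ (x ≈ 0#) → ¬ (y ≈ 0#) → ¬ (x * y ≈ 0#)
  *-nonzero {x} x≉0 y≉0 xy≈0 = y≉0 (*-cancelˡ-nonzero x≉0 (trans xy≈0 (sym (zeroʳ x))))

  ^-nonzero : ∀ {x} → ¬ (x ≈ 0#) → ∀ k → ¬ (x ^ k ≈ 0#)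
  ^-nonzero x≉0 zero    = 1≉0
  ^-nonzero x≉0 (suc k) = *-nonzero x≉0 (^-nonzero x≉0 k)

  complement : ∀ z → z + (1# - z) ≈ 1#
  complement z = trans (+-comm z (1# - z)) (//-rightDividesˡ z 1#)

  complement-unique : ∀ {a b} → a + b ≈ 1# → b ≈ 1# - a
  complement-unique {a} {b} a+b≈1 = x≈z//y b a 1# (trans (+-comm b a) a+b≈1)

  complement-nonzero : ∀ {z} → ¬ (z ≈ 1#) → ¬ (1# - z ≈ 0#)
  complement-nonzero {z} z≉1 w≈0 =
    z≉1 (trans (sym (+-identityʳ z)) (trans (+-congˡ (sym w≈0)) (complement z)))

  complement-not-one : ∀ {z} → ¬ (z ≈ 0#) → ¬ (1# - z ≈ 1#)
  complement-not-one {z} z≉0 w≈1 = z≉0 (∙-cancelʳ 1# z 0# (begin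
    z + 1#          ≈⟨ +-congˡ (sym w≈1) ⟩
    z + (1# - z)    ≈⟨ complement z ⟩
    1#              ≈⟨ sym (+-identityˡ 1#) ⟩
    0# + 1#         ∎))

module NonzeroElements {n : ℕ} (F : FiniteField (suc n)) where
  open FiniteField F

  zeroIndex : Fin (suc n)
  zeroIndex = proj₁ (enum-surj 0#)

  nonzeroAt : Fin n → Carrier
  nonzeroAt j = enum (punchIn zeroIndex j)

  nonzeroAt-nonzero : ∀ j → ¬ (nonzeroAt j ≈ 0#)
  nonzeroAt-nonzero j j≈0 = Fin.punchInᵢ≢i zeroIndex j
    (enum-inj _ _ (trans j≈0 (sym (proj₂ (enum-surj 0#)))))

  zeroIndex≢index : ∀ {x} → ¬ (x ≈ 0#) → zeroIndex ≢ proj₁ (enum-surj x)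
  zeroIndex≢index {x} x≉0 e = x≉0 (trans (sym (proj₂ (enum-surj x)))
    (trans (reflexive (≡.cong enum (≡.sym e))) (proj₂ (enum-surj 0#))))

  positionOf : ∀ x → ¬ (x ≈ 0#) → Fin n
  positionOf x x≉0 = punchOut (zeroIndex≢index x≉0)

  positionOf-injective : ∀ {x y} x≉0 y≉0 → positionOf x x≉0 ≡ positionOf y y≉0 → x ≈ y
  positionOf-injective {x} {y} x≉0 y≉0 e = trans (sym (proj₂ (enum-surj x)))
    (trans (reflexive (≡.cong enum (Fin.punchOut-injective (zeroIndex≢index x≉0) (zeroIndex≢index y≉0) e)))
      (proj₂ (enum-surj y)))

  nonzero-injection-bound : ∀ d (φ : Carrier → ℕ) → (∀ x → ¬ (x ≈ 0#) → φ x <ℕ d) →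
    (∀ x y → ¬ (x ≈ 0#) → ¬ (y ≈ 0#) → φ x ≡ φ y → x ≈ y) → n ≤ℕ d
  nonzero-injection-bound d φ bounded injective = Fin.injective⇒≤ code-injective
    where
    code : Fin n → Fin d
    code j = fromℕ< (bounded (nonzeroAt j) (nonzeroAt-nonzero j))
    code-injective : ∀ {j k} → code j ≡ code k → j ≡ k
    code-injective {j} {k} e = Fin.punchIn-injective zeroIndex j k (enum-inj _ _
      (injective (nonzeroAt j) (nonzeroAt k) (nonzeroAt-nonzero j) (nonzeroAt-nonzero k)
        (≡.trans (≡.sym (Fin.toℕ-fromℕ< _)) (≡.trans (≡.cong toℕ e) (Fin.toℕ-fromℕ< _)))))

  nonzero-pigeonhole : (g : Fin (suc n) → Carrier) → (∀ t → ¬ (g t ≈ 0#)) →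
    ∃ λ s → ∃ λ t → toℕ s <ℕ toℕ t × g s ≈ g t
  nonzero-pigeonhole g g≉0
    with s , t , s<t , e ← Fin.pigeonhole (ℕ.n<1+n n) (λ t → positionOf (g t) (g≉0 t)) =
    s , t , s<t , positionOf-injective (g≉0 s) (g≉0 t) e

module Cyclic (n : ℕ) .{{_ : NonZero n}} (F : FiniteField (suc n))
              (γ : FiniteField.Carrier F) (generator : IsGenerator F γ) where
  open FiniteField F
  open FieldArithmetic F
  open NonzeroElements F
  open import Relation.Binary.Reasoning.Setoid setoid

  γ≉0 : ¬ (γ ≈ 0#)
  γ≉0 = proj₁ generator

  -- some exponent k with γ^k = x (chosen as 0 for x = 0)
  exponentOf : Carrier → ℕ
  exponentOf x with x ≟ 0#
  ... | yes _   = 0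
  ... | no x≉0 = proj₁ (proj₂ generator x x≉0)

  exponentOf-spec : ∀ x → ¬ (x ≈ 0#) → γ ^ exponentOf x ≈ x
  exponentOf-spec x x≉0 with x ≟ 0#
  ... | yes x≈0 = ⊥-elim (x≉0 x≈0)
  ... | no x≉0′ = proj₂ (proj₂ generator x x≉0′)

  power-collision⇒period : ∀ {a b} → a ≤ℕ b → γ ^ a ≈ γ ^ b → γ ^ (b ∸ℕ a) ≈ 1#
  power-collision⇒period {a} {b} a≤b γᵃ≈γᵇ = sym (*-cancelˡ-nonzero (^-nonzero γ≉0 a) (begin
    γ ^ a * 1#                ≈⟨ *-identityʳ _ ⟩
    γ ^ a                     ≈⟨ γᵃ≈γᵇ ⟩
    γ ^ b                     ≡⟨ ≡.cong (γ ^_) (≡.sym (ℕ.m+[n∸m]≡n a≤b)) ⟩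
    γ ^ (a +ℕ (b ∸ℕ a))       ≈⟨ ^-+ γ a _ ⟩
    γ ^ a * γ ^ (b ∸ℕ a)      ∎))

  -- every positive period is at least n: x ↦ exponentOf x % d is injective on F^*
  period-≥ : ∀ d → 0 <ℕ d → γ ^ d ≈ 1# → n ≤ℕ d
  period-≥ d@(suc _) _ γᵈ≈1 =
    nonzero-injection-bound d (λ x → exponentOf x % d) (λ x _ → m%n<n (exponentOf x) d)
      λ x y x≉0 y≉0 e → begin
        x                         ≈⟨ sym (exponentOf-spec x x≉0) ⟩
        γ ^ exponentOf x          ≈⟨ ^-mod d γᵈ≈1 (exponentOf x) ⟩
        γ ^ (exponentOf x % d)    ≡⟨ ≡.cong (γ ^_) e ⟩
        γ ^ (exponentOf y % d)    ≈⟨ sym (^-mod d γᵈ≈1 (exponentOf y)) ⟩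
        γ ^ exponentOf y          ≈⟨ exponentOf-spec y y≉0 ⟩
        y                         ∎

  -- γ has order exactly n: two of γ^0, …, γ^n coincide, giving a period ≤ n
  γⁿ≈1 : γ ^ n ≈ 1#
  γⁿ≈1 with s , t , s<t , γˢ≈γᵗ ← nonzero-pigeonhole (λ t → γ ^ toℕ t) (λ t → ^-nonzero γ≉0 (toℕ t)) =
    ≡.subst (λ k → γ ^ k ≈ 1#) period≡n period
    where
    period : γ ^ (toℕ t ∸ℕ toℕ s) ≈ 1#
    period = power-collision⇒period (ℕ.<⇒≤ s<t) γˢ≈γᵗ
    period≡n : toℕ t ∸ℕ toℕ s ≡ n
    period≡n = ℕ.≤-antisym (ℕ.≤-trans (ℕ.m∸n≤m (toℕ t) (toℕ s)) (Fin.toℕ≤pred[n] t))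
                           (period-≥ _ (ℕ.m<n⇒0<n∸m s<t) period)

  -- no two of the powers γ^0, …, γ^(n-1) coincide, since that would give a period < n
  no-early-repetition : ∀ {a b} → a <ℕ b → b <ℕ n → ¬ (γ ^ a ≈ γ ^ b)
  no-early-repetition {a} {b} a<b b<n γᵃ≈γᵇ = ℕ.<⇒≱ (ℕ.≤-<-trans (ℕ.m∸n≤m b a) b<n)
    (period-≥ _ (ℕ.m<n⇒0<n∸m a<b) (power-collision⇒period (ℕ.<⇒≤ a<b) γᵃ≈γᵇ))

  power-injective : ∀ {a b} → a <ℕ n → b <ℕ n → γ ^ a ≈ γ ^ b → a ≡ b
  power-injective {a} {b} a<n b<n γᵃ≈γᵇ with ℕ.<-cmp a b
  ... | tri< a<b _ _ = ⊥-elim (no-early-repetition a<b b<n γᵃ≈γᵇ)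
  ... | tri≈ _ a≡b _ = a≡b
  ... | tri> _ _ b<a = ⊥-elim (no-early-repetition b<a a<n (sym γᵃ≈γᵇ))

  log : Carrier → ℕ
  log x = exponentOf x % n

  log<n : ∀ x → log x <ℕ n
  log<n x = m%n<n (exponentOf x) n

  γ^log : ∀ x → ¬ (x ≈ 0#) → γ ^ log x ≈ x
  γ^log x x≉0 = trans (sym (^-mod n γⁿ≈1 (exponentOf x))) (exponentOf-spec x x≉0)

  log-positive : ∀ {x} → ¬ (x ≈ 0#) → ¬ (x ≈ 1#) → 0 <ℕ log x
  log-positive {x} x≉0 x≉1 = ℕ.n≢0⇒n>0 λ log≡0 →
    x≉1 (trans (sym (γ^log x x≉0)) (reflexive (≡.cong (γ ^_) log≡0)))

  -- t + t written as t * 2, the shape of witnesses of 2 ∣ k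
  double : ∀ t → t +ℕ t ≡ t *ℕ 2
  double t = ≡.trans (≡.cong (t +ℕ_) (≡.sym (ℕ.+-identityʳ t))) (ℕ.*-comm 2 t)

  even-power-square : ∀ k → 2 ∣ k → IsSquare F (γ ^ k)
  even-power-square k (divides t k≡2t) =
    γ ^ t , trans (sym (^-+ γ t t)) (reflexive (≡.cong (γ ^_) (≡.trans (double t) (≡.sym k≡2t))))

  -- for even n, a square γ^k = y^2 with k < n has k ≡ 2 log y (mod n), which is even
  square-power-even : 2 ∣ n → ∀ k → k <ℕ n → IsSquare F (γ ^ k) → 2 ∣ k
  square-power-even 2∣n k k<n (y , y²≈γᵏ) = ≡.subst (2 ∣_) 2e%n≡k 2∣2e%n
    where
    y≉0 : ¬ (y ≈ 0#)
    y≉0 y≈0 = ^-nonzero γ≉0 k (trans (sym y²≈γᵏ) (trans (*-congʳ y≈0) (zeroˡ y)))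
    2e : ℕ
    2e = exponentOf y +ℕ exponentOf y
    2e%n≡k : 2e % n ≡ k
    2e%n≡k = power-injective (m%n<n 2e n) k<n (begin
      γ ^ (2e % n)                          ≈⟨ sym (^-mod n γⁿ≈1 2e) ⟩
      γ ^ 2e                                ≈⟨ ^-+ γ (exponentOf y) (exponentOf y) ⟩
      γ ^ exponentOf y * γ ^ exponentOf y   ≈⟨ *-cong (exponentOf-spec y y≉0) (exponentOf-spec y y≉0) ⟩
      y * y                                 ≈⟨ y²≈γᵏ ⟩
      γ ^ k                                 ∎)
    -- 2e = 2e % n + (2e / n) * n with 2 ∣ 2e and 2 ∣ n
    2∣2e%n : 2 ∣ 2e % n
    2∣2e%n = ∣m+n∣m⇒∣n
      (≡.subst (2 ∣_) (≡.trans (m≡m%n+[m/n]*n 2e n) (ℕ.+-comm (2e % n) _))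
        (divides (exponentOf y) (double (exponentOf y))))
      (∣-trans 2∣n (n∣m*n (2e / n)))

module Correspondence (m : ℕ) (F : FiniteField (suc (suc m))) (α β : FiniteField.Carrier F)
                      (α-gen : IsGenerator F α) (β-gen : IsGenerator F β) (2∣n : 2 ∣ suc m) where
  open FiniteField F
  open FieldArithmetic F
  module A = Cyclic (suc m) F α α-gen
  module B = Cyclic (suc m) F β β-gen

  n : ℕ
  n = suc m

  dots : List (ℕ × ℕ)
  dots = filter (evenEvenDot? F α β) (cartesianProduct (indices F) (indices F))

  goodElems : List (Fin (suc n))
  goodElems = filter (λ k → goodElem? F (enum k)) (allFin (suc n))

  ∈-indices⁻ : ∀ {i} → i ∈ indices F → 0 <ℕ i × i <ℕ n
  ∈-indices⁻ p with k , k∈ , ≡.refl ← ∈-map⁻ suc p = s≤s z≤n , s≤s (∈-upTo⁻ k∈)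

  ∈-indices⁺ : ∀ {i} → 0 <ℕ i → i <ℕ n → i ∈ indices F
  ∈-indices⁺ {suc k} _ (s≤s k<m) = ∈-map⁺ suc (∈-upTo⁺ k<m)

  ∈-dots⁻ : ∀ {i j} → (i , j) ∈ dots →
    (0 <ℕ i × i <ℕ n) × (0 <ℕ j × j <ℕ n) × EvenEvenDot F α β (i , j)
  ∈-dots⁻ p with in-grid , dot ← ∈-filter⁻ (evenEvenDot? F α β) {xs = cartesianProduct (indices F) (indices F)} p
            with i∈ , j∈ ← ∈-cartesianProduct⁻ (indices F) (indices F) in-grid =
    ∈-indices⁻ i∈ , ∈-indices⁻ j∈ , dot

  ∈-dots⁺ : ∀ {i j} → 0 <ℕ i → i <ℕ n → 0 <ℕ j → j <ℕ n → EvenEvenDot F α β (i , j) → (i , j) ∈ dots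
  ∈-dots⁺ 0<i i<n 0<j j<n dot = ∈-filter⁺ (evenEvenDot? F α β)
    (∈-cartesianProduct⁺ (∈-indices⁺ 0<i i<n) (∈-indices⁺ 0<j j<n)) dot

  ∈-goodElems⁻ : ∀ {k} → k ∈ goodElems → GoodElem F (enum k)
  ∈-goodElems⁻ p = proj₂ (∈-filter⁻ (λ k → goodElem? F (enum k)) {xs = allFin _} p)

  ∈-goodElems⁺ : ∀ {k} → GoodElem F (enum k) → k ∈ goodElems
  ∈-goodElems⁺ good = ∈-filter⁺ (λ k → goodElem? F (enum k)) (∈-allFin _) good

  dotToElem : ℕ × ℕ → Fin (suc n)
  dotToElem (i , j) = proj₁ (enum-surj (α ^ i))

  dotToElem-spec : ∀ i j → enum (dotToElem (i , j)) ≈ α ^ i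
  dotToElem-spec i j = proj₂ (enum-surj (α ^ i))

  dot-complement : ∀ {i j} → (i , j) ∈ dots → 1# - α ^ i ≈ β ^ j
  dot-complement p with _ , _ , _ , _ , α^i+β^j≈1 ← ∈-dots⁻ p = sym (complement-unique α^i+β^j≈1)

  dotToElem-good : ∀ {p} → p ∈ dots → dotToElem p ∈ goodElems
  dotToElem-good {i , j} p with (0<i , i<n) , _ , 2∣i , 2∣j , _ ← ∈-dots⁻ p =
    ∈-goodElems⁺ (z≉0 , z≉1 , z-square , 1-z-square)
    where
    z = enum (dotToElem (i , j))
    z≈α^i : z ≈ α ^ i
    z≈α^i = dotToElem-spec i j
    z≉0 : ¬ (z ≈ 0#)
    z≉0 z≈0 = ^-nonzero A.γ≉0 i (trans (sym z≈α^i) z≈0)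
    z≉1 : ¬ (z ≈ 1#)
    z≉1 z≈1 = ℕ.<⇒≢ 0<i (≡.sym (A.power-injective i<n (s≤s z≤n) (trans (sym z≈α^i) z≈1)))
    z-square : IsSquare F z
    z-square with y , y²≈α^i ← A.even-power-square i 2∣i = y , trans y²≈α^i (sym z≈α^i)
    1-z-square : IsSquare F (1# - z)
    1-z-square with y , y²≈β^j ← B.even-power-square j 2∣j =
      y , trans y²≈β^j (sym (trans (+-congˡ (-‿cong z≈α^i)) (dot-complement p)))

  -- a dot is determined by α^i, since 0 < i, j < n
  dotToElem-injective : ∀ {p p′} → p ∈ dots → p′ ∈ dots → dotToElem p ≡ dotToElem p′ → p ≡ p′
  dotToElem-injective {i , j} {i′ , j′} p p′ e = ≡.cong₂ _,_ i≡i′ j≡j′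
    where
    i<n = proj₂ (proj₁ (∈-dots⁻ p))
    i′<n = proj₂ (proj₁ (∈-dots⁻ p′))
    j<n = proj₂ (proj₁ (proj₂ (∈-dots⁻ p)))
    j′<n = proj₂ (proj₁ (proj₂ (∈-dots⁻ p′)))
    i≡i′ : i ≡ i′
    i≡i′ = A.power-injective i<n i′<n
      (trans (sym (dotToElem-spec i j)) (trans (reflexive (≡.cong enum e)) (dotToElem-spec i′ j′)))
    j≡j′ : j ≡ j′
    j≡j′ = B.power-injective j<n j′<n (trans (sym (dot-complement p))
      (trans (reflexive (≡.cong (λ k → 1# - α ^ k) i≡i′)) (dot-complement p′)))

  elemToDot : Fin (suc n) → ℕ × ℕ
  elemToDot k = A.log (enum k) , B.log (1# - enum k)

  elemToDot-dot : ∀ {k} → k ∈ goodElems → elemToDot k ∈ dots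
  elemToDot-dot {k} p with z≉0 , z≉1 , (y , y²≈z) , (y′ , y′²≈w) ← ∈-goodElems⁻ p =
    ∈-dots⁺ (A.log-positive z≉0 z≉1) (A.log<n z)
            (B.log-positive w≉0 (complement-not-one z≉0)) (B.log<n w)
            (2∣i , 2∣j , trans (+-cong α^i≈z β^j≈w) (complement z))
    where
    z = enum k
    w = 1# - z
    w≉0 = complement-nonzero z≉1
    α^i≈z = A.γ^log z z≉0
    β^j≈w = B.γ^log w w≉0
    2∣i : 2 ∣ A.log z
    2∣i = A.square-power-even 2∣n (A.log z) (A.log<n z) (y , trans y²≈z (sym α^i≈z))
    2∣j : 2 ∣ B.log w
    2∣j = B.square-power-even 2∣n (B.log w) (B.log<n w) (y′ , trans y′²≈w (sym β^j≈w))

  -- z = α^(log_α z) is recovered from the first coordinate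
  elemToDot-injective : ∀ {k k′} → k ∈ goodElems → k′ ∈ goodElems → elemToDot k ≡ elemToDot k′ → k ≡ k′
  elemToDot-injective {k} {k′} p p′ e = enum-inj k k′
    (trans (sym (A.γ^log _ (proj₁ (∈-goodElems⁻ p))))
      (trans (reflexive (≡.cong (λ ij → α ^ proj₁ ij) e)) (A.γ^log _ (proj₁ (∈-goodElems⁻ p′)))))

  count-equality : evenEvenDotCount F α β ≡ goodElemCount F
  count-equality = ℕ.≤-antisym
    (length-≤-by-injection dotToElem dots-unique dotToElem-good dotToElem-injective)
    (length-≤-by-injection elemToDot goodElems-unique elemToDot-dot elemToDot-injective)
    where
    dots-unique : Unique dots
    dots-unique = Unique.filter⁺ (evenEvenDot? F α β) (Unique.cartesianProduct⁺ indices-unique indices-unique)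
      where indices-unique = Unique.map⁺ ℕ.suc-injective (Unique.upTo⁺ m)
    goodElems-unique : Unique goodElems
    goodElems-unique = Unique.filter⁺ (λ k → goodElem? F (enum k)) (Unique.allFin⁺ _)

no-field-of-size-one : FiniteField 1 → ⊥
no-field-of-size-one F = 1≉0 (trans (sym (one-index-surj 1#)) (one-index-surj 0#))
  where
  open FiniteField F
  one-index-surj : ∀ x → enum fzero ≈ x
  one-index-surj x with fzero , e ← enum-surj x = e

odd⇒pred-even : ∀ n → suc n % 2 ≡ 1 → 2 ∣ n
odd⇒pred-even n odd = divides (suc n / 2) (ℕ.suc-injective (begin
  suc n                         ≡⟨ m≡m%n+[m/n]*n (suc n) 2 ⟩
  suc n % 2 +ℕ (suc n / 2) *ℕ 2 ≡⟨ ≡.cong (_+ℕ (suc n / 2) *ℕ 2) odd ⟩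
  suc ((suc n / 2) *ℕ 2)        ∎))
  where open ≡.≡-Reasoning

lemma6 : (q : ℕ) → q % 2 ≡ 1 → (F : FiniteField q) → (α β : FiniteField.Carrier F) →
    IsGenerator F α → IsGenerator F β →
    evenEvenDotCount F α β ≡ goodElemCount F
lemma6 zero          ()
lemma6 (suc zero)    _   F = ⊥-elim (no-field-of-size-one F)
lemma6 (suc (suc m)) odd F α β α-gen β-gen =
  Correspondence.count-equality m F α β α-gen β-gen (odd⇒pred-even (suc m) odd)
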